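{- For every positive integer $t$, the number of leaves of $T$ that are descendants of the $t$-th supernode is $a_t$.
   Context: Fix nonnegative integers $\lambda_1,\lambda_2,\dots$ and an integer $k\ge1$ (the order) such that $\lambda_1\ge1$, $\lambda_k\ge1$, $\lambda_i=0$ for $i>k$, and $\lambda_1\ge2$ if $k=1$. Define $(a_n)_{n\in\mathbb Z}$ by $a_n=1$ for $n\le0$ and $a_n=\sum_{i=1}^k\lambda_ia_{n-i}$ for $n\ge1$. Let $\Lambda_j=\sum_{i=1}^j\lambda_i$ and $\Lambda=\Lambda_k$. Trees are ordered. Finite trees $T_j$: $T_0$ is a single node; for $j\ge1$, $T_j$ has a chain of special nodes $s_j$ (root), $\dots,s_0$ with $s_i$ on level $i$ and $s_{i-1}$ the leftmost child of $s_i$, and $s_i$ ($1\le i\le j$) has $\Lambda_{j-i+1}$ children: $s_{i-1}$ followed by $\Lambda_{j-i+1}-1$ roots of copies of $T_{i-1}$. The skeleton $T$ is the infinite rootless tree with special nodes $u_0,u_1,\dots$, where $u_0$ is a leaf, $u_{i-1}$ is the leftmost child of $u_i$, and for $i\ge1$ the $i$-th supernode $u_i$ has, to the right of $u_{i-1}$, exactly $\Lambda-1$ further children, each the root of a copy of $T_{i-1}$. -}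

module Defs where

open import Data.Nat using (ℕ; zero; suc; _+_; _*_; _∸_; _≤_; _<_)
open import Data.List using (List; []; _∷_; replicate; map; upTo)
open import Data.Nat.ListAction using (sum)
open import Data.Product using (_×_)
open import Relation.Binary.PropositionalEquality using (_≡_)

-- Coefficients λ₁, λ₂, … are given as a function lam : ℕ → ℕ,
-- where lam i is λ_i for i ≥ 1 (the value lam 0 is never used).

record Admissible (lam : ℕ → ℕ) (k : ℕ) : Set where
  field
    k≥1      : 1 ≤ k
    λ₁≥1     : 1 ≤ lam 1
    λk≥1     : 1 ≤ lam k
    vanish   : ∀ i → k < i → lam i ≡ 0
    order1   : k ≡ 1 → 2 ≤ lam 1

Lam : (ℕ → ℕ) → ℕ → ℕ
Lam lam zero    = 0
Lam lam (suc j) = Lam lam j + lam (suc j)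

nth : List ℕ → ℕ → ℕ → ℕ
nth []       _       d = d
nth (x ∷ xs) zero    d = x
nth (x ∷ xs) (suc i) d = nth xs i d

-- hist lam k m = [a_m, a_{m-1}, …, a_1]; entries a_n with n ≤ 0 are the default 1.
hist : (ℕ → ℕ) → ℕ → ℕ → List ℕ
hist lam k zero    = []
hist lam k (suc m) =
  sum (map (λ i → lam (suc i) * nth (hist lam k m) i 1) (upTo k)) ∷ hist lam k m

-- a_n for n ≥ 0 (with a_0 = 1; a_n = Σ_{i=1}^k λ_i a_{n-i}, a_n = 1 for n ≤ 0)
seqA : (ℕ → ℕ) → ℕ → ℕ → ℕ
seqA lam k n = nth (hist lam k n) 0 1

data Tree : Set where
  node : List Tree → Tree

leaf : Tree
leaf = node []

mutual
  leaves : Tree → ℕ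
  leaves (node [])       = 1
  leaves (node (c ∷ cs)) = leavesL (c ∷ cs)

  leavesL : List Tree → ℕ
  leavesL []       = 0
  leavesL (c ∷ cs) = leaves c + leavesL cs

mutual
  Tfin : (ℕ → ℕ) → ℕ → Tree
  Tfin lam zero    = leaf
  Tfin lam (suc j) = Sfin lam (suc j) (suc j)

  -- Sfin lam j i = subtree of T_j rooted at the special node s_i (0 ≤ i ≤ j):
  -- s_i has Λ_{j-i+1} children: s_{i-1} followed by Λ_{j-i+1} - 1 copies of T_{i-1}.
  Sfin : (ℕ → ℕ) → ℕ → ℕ → Tree
  Sfin lam j zero    = leaf
  Sfin lam j (suc i) =
    node (Sfin lam j i ∷ replicate (Lam lam (j ∸ i) ∸ 1) (Tfin lam i))

-- Descendant subtree of the supernode u_i in the skeleton T (u_0 is a leaf;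
-- u_i has children u_{i-1} followed by Λ - 1 copies of T_{i-1}), Λ = Λ_k.
Usub : (ℕ → ℕ) → ℕ → ℕ → Tree
Usub lam k zero    = leaf
Usub lam k (suc i) =
  node (Usub lam k i ∷ replicate (Lam lam k ∸ 1) (Tfin lam i))

{-# OPTIONS --safe #-}

-- Let L j be the number of leaves of T_j and S n = L 0 + ⋯ + L (n - 1).
-- Reading off the special chain of T_j gives L j = 1 + Σ_{m<j} (Λ_{j-m} - 1) L m,
-- hence S (j + 1) = 1 + Σ_{m<j} Λ_{j-m} L m.  Writing Λ as a prefix sum of λ and
-- swapping the triangular double sum turns this into
-- S (j + 1) = 1 + Σ_i λ_{i+1} S (j - i).  The supernode u_n has 1 + (Λ - 1) S n
-- leaves, and the recurrence for S is exactly what makes these numbers satisfy the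
-- defining recurrence of a_n; as that recurrence determines the sequence, they agree.

module Submission where

open import Defs
open import Data.Nat using (ℕ; zero; suc; _+_; _*_; _∸_; _≤_; _<_; z≤n; s≤s)
open import Data.Nat.Properties
open import Data.Nat.Induction using (<-rec)
open import Data.Nat.ListAction using (sum)
open import Data.List using (replicate; map; applyUpTo; upTo)
open import Algebra.Properties.CommutativeSemigroup +-commutativeSemigroup using (interchange)
open import Algebra.Properties.CommutativeSemigroup *-commutativeSemigroup using (x∙yz≈y∙xz)
open import Relation.Binary.PropositionalEquality
open ≡-Reasoning

∑< : ℕ → (ℕ → ℕ) → ℕ
∑< zero    f = 0
∑< (suc n) f = ∑< n f + f n

infix 5 ∑<
syntax ∑< n (λ i → e) = ∑[ i < n ] e

∑<-cong : ∀ n {f g : ℕ → ℕ} → (∀ i → i < n → f i ≡ g i) → ∑< n f ≡ ∑< n g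
∑<-cong zero    eq = refl
∑<-cong (suc n) eq = cong₂ _+_ (∑<-cong n (λ i i<n → eq i (m<n⇒m<1+n i<n))) (eq n ≤-refl)

∑<-+ : ∀ n (f g : ℕ → ℕ) → ∑[ i < n ] (f i + g i) ≡ ∑< n f + ∑< n g
∑<-+ zero    f g = refl
∑<-+ (suc n) f g = trans (cong (_+ (f n + g n)) (∑<-+ n f g)) (interchange (∑< n f) (∑< n g) (f n) (g n))

∑<-*ˡ : ∀ n c (f : ℕ → ℕ) → ∑[ i < n ] (c * f i) ≡ c * ∑< n f
∑<-*ˡ zero    c f = sym (*-zeroʳ c)
∑<-*ˡ (suc n) c f = trans (cong (_+ c * f n) (∑<-*ˡ n c f)) (sym (*-distribˡ-+ c (∑< n f) (f n)))

∑<-*ʳ : ∀ n c (f : ℕ → ℕ) → ∑[ i < n ] (f i * c) ≡ ∑< n f * c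
∑<-*ʳ n c f = begin
  ∑[ i < n ] (f i * c) ≡⟨ ∑<-cong n (λ i _ → *-comm (f i) c) ⟩
  ∑[ i < n ] (c * f i) ≡⟨ ∑<-*ˡ n c f ⟩
  c * ∑< n f           ≡⟨ *-comm c (∑< n f) ⟩
  ∑< n f * c           ∎

∑<-sucˡ : ∀ n (f : ℕ → ℕ) → ∑< (suc n) f ≡ f 0 + (∑[ i < n ] f (suc i))
∑<-sucˡ zero    f = +-comm 0 (f 0)
∑<-sucˡ (suc n) f = trans (cong (_+ f (suc n)) (∑<-sucˡ n f)) (+-assoc (f 0) _ _)

∑<-reverse : ∀ n (f : ℕ → ℕ) → ∑< n f ≡ ∑[ i < n ] f (n ∸ suc i)
∑<-reverse zero    f = refl
∑<-reverse (suc n) f = begin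
  ∑< n f + f n                         ≡⟨ +-comm (∑< n f) (f n) ⟩
  f n + ∑< n f                         ≡⟨ cong (f n +_) (∑<-reverse n f) ⟩
  f n + (∑[ i < n ] f (n ∸ suc i))     ≡⟨ sym (∑<-sucˡ n (λ i → f (n ∸ i))) ⟩
  ∑[ i < suc n ] f (n ∸ i)             ∎

∑<-vanishing : ∀ m d (f : ℕ → ℕ) → (∀ i → m ≤ i → f i ≡ 0) → ∑< (m + d) f ≡ ∑< m f
∑<-vanishing m zero    f vanish = cong (λ n → ∑< n f) (+-identityʳ m)
∑<-vanishing m (suc d) f vanish = begin
  ∑< (m + suc d) f         ≡⟨ cong (λ n → ∑< n f) (+-suc m d) ⟩
  ∑< (m + d) f + f (m + d) ≡⟨ cong₂ _+_ (∑<-vanishing m d f vanish) (vanish (m + d) (m≤m+n m d)) ⟩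
  ∑< m f + 0               ≡⟨ +-identityʳ _ ⟩
  ∑< m f                   ∎

sum-map-applyUpTo : ∀ n (f g : ℕ → ℕ) → sum (map f (applyUpTo g n)) ≡ ∑[ i < n ] f (g i)
sum-map-applyUpTo zero    f g = refl
sum-map-applyUpTo (suc n) f g = begin
  f (g 0) + sum (map f (applyUpTo (λ i → g (suc i)) n))
    ≡⟨ cong (f (g 0) +_) (sum-map-applyUpTo n f (λ i → g (suc i))) ⟩
  f (g 0) + (∑[ i < n ] f (g (suc i)))
    ≡⟨ sym (∑<-sucˡ n (λ i → f (g i))) ⟩
  ∑[ i < suc n ] f (g i) ∎

sum-map-upTo : ∀ n (f : ℕ → ℕ) → sum (map f (upTo n)) ≡ ∑< n f
sum-map-upTo n f = sum-map-applyUpTo n f (λ i → i)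

∑<-triangle-suc : ∀ j (h : ℕ → ℕ → ℕ) →
  ∑[ m < suc j ] ∑[ i < suc j ∸ m ] h i m ≡
  (∑[ m < j ] ∑[ i < j ∸ m ] h i m) + (∑[ m < suc j ] h (j ∸ m) m)
∑<-triangle-suc j h = begin
  (∑[ m < j ] ∑[ i < suc j ∸ m ] h i m) + (∑[ i < suc j ∸ j ] h i j)
    ≡⟨ cong₂ _+_ (∑<-cong j (λ m m<j → cong (λ n → ∑[ i < n ] h i m) (+-∸-assoc 1 (<⇒≤ m<j))))
                 (cong (λ n → ∑[ i < n ] h i j) (m+n∸n≡m 1 j)) ⟩
  (∑[ m < j ] ((∑[ i < j ∸ m ] h i m) + h (j ∸ m) m)) + h 0 j
    ≡⟨ cong₂ _+_ (∑<-+ j (λ m → ∑[ i < j ∸ m ] h i m) (λ m → h (j ∸ m) m))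
                 (cong (λ i → h i j) (sym (n∸n≡0 j))) ⟩
  (∑[ m < j ] ∑[ i < j ∸ m ] h i m) + (∑[ m < j ] h (j ∸ m) m) + h (j ∸ j) j
    ≡⟨ +-assoc (∑[ m < j ] ∑[ i < j ∸ m ] h i m) _ _ ⟩
  (∑[ m < j ] ∑[ i < j ∸ m ] h i m) + (∑[ m < suc j ] h (j ∸ m) m) ∎

∑<-antidiagonal-swap : ∀ j (h : ℕ → ℕ → ℕ) →
  ∑[ m < suc j ] h (j ∸ m) m ≡ ∑[ i < suc j ] h i (j ∸ i)
∑<-antidiagonal-swap j h = begin
  ∑[ m < suc j ] h (j ∸ m) m
    ≡⟨ ∑<-reverse (suc j) (λ m → h (j ∸ m) m) ⟩
  ∑[ i < suc j ] h (j ∸ (j ∸ i)) (j ∸ i)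
    ≡⟨ ∑<-cong (suc j) (λ i i<1+j → cong (λ m → h m (j ∸ i)) (m∸[m∸n]≡n (≤-pred i<1+j))) ⟩
  ∑[ i < suc j ] h i (j ∸ i) ∎

∑<-triangle-swap : ∀ j (h : ℕ → ℕ → ℕ) →
  ∑[ m < j ] ∑[ i < j ∸ m ] h i m ≡ ∑[ i < j ] ∑[ m < j ∸ i ] h i m
∑<-triangle-swap zero    h = refl
∑<-triangle-swap (suc j) h = begin
  ∑[ m < suc j ] ∑[ i < suc j ∸ m ] h i m
    ≡⟨ ∑<-triangle-suc j h ⟩
  (∑[ m < j ] ∑[ i < j ∸ m ] h i m) + (∑[ m < suc j ] h (j ∸ m) m)
    ≡⟨ cong₂ _+_ (∑<-triangle-swap j h) (∑<-antidiagonal-swap j h) ⟩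
  (∑[ i < j ] ∑[ m < j ∸ i ] h i m) + (∑[ i < suc j ] h i (j ∸ i))
    ≡⟨ sym (∑<-triangle-suc j (λ m i → h i m)) ⟩
  ∑[ i < suc j ] ∑[ m < suc j ∸ i ] h i m ∎

∑<-convolution : ∀ j (f g : ℕ → ℕ) →
  ∑[ m < j ] (∑< (j ∸ m) f * g m) ≡ ∑[ i < j ] (f i * ∑< (j ∸ i) g)
∑<-convolution j f g = begin
  ∑[ m < j ] (∑< (j ∸ m) f * g m)        ≡⟨ ∑<-cong j (λ m _ → sym (∑<-*ʳ (j ∸ m) (g m) f)) ⟩
  ∑[ m < j ] ∑[ i < j ∸ m ] (f i * g m)  ≡⟨ ∑<-triangle-swap j (λ i m → f i * g m) ⟩
  ∑[ i < j ] ∑[ m < j ∸ i ] (f i * g m)  ≡⟨ ∑<-cong j (λ i _ → ∑<-*ˡ (j ∸ i) (f i) g) ⟩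
  ∑[ i < j ] (f i * ∑< (j ∸ i) g)        ∎

leavesL-replicate : ∀ n t → leavesL (replicate n t) ≡ n * leaves t
leavesL-replicate zero    t = refl
leavesL-replicate (suc n) t = cong (leaves t +_) (leavesL-replicate n t)

Lam-∑< : ∀ lam n → Lam lam n ≡ ∑[ i < n ] lam (suc i)
Lam-∑< lam zero    = refl
Lam-∑< lam (suc n) = cong (_+ lam (suc n)) (Lam-∑< lam n)

Lam-positive : ∀ {lam n} → 1 ≤ lam 1 → 0 < n → 1 ≤ Lam lam n
Lam-positive {n = 1}                 λ₁≥1 _ = λ₁≥1
Lam-positive {lam} {n = suc (suc n)} λ₁≥1 _ =
  ≤-trans (Lam-positive {n = suc n} λ₁≥1 (s≤s z≤n)) (m≤m+n _ (lam (suc (suc n))))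

[m∸1]*n+n≡m*n : ∀ {m} n → 1 ≤ m → (m ∸ 1) * n + n ≡ m * n
[m∸1]*n+n≡m*n n (s≤s _) = +-comm _ n

module LeafCounts (lam : ℕ → ℕ) where

  L : ℕ → ℕ
  L j = leaves (Tfin lam j)

  S : ℕ → ℕ
  S n = ∑< n L

  leaves-Sfin : ∀ j i → leaves (Sfin lam j i) ≡ 1 + (∑[ m < i ] ((Lam lam (j ∸ m) ∸ 1) * L m))
  leaves-Sfin j zero    = refl
  leaves-Sfin j (suc i) =
    cong₂ _+_ (leaves-Sfin j i) (leavesL-replicate (Lam lam (j ∸ i) ∸ 1) (Tfin lam i))

  leaves-Tfin : ∀ j → L j ≡ 1 + (∑[ m < j ] ((Lam lam (j ∸ m) ∸ 1) * L m))
  leaves-Tfin zero    = refl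
  leaves-Tfin (suc j) = leaves-Sfin (suc j) (suc j)

  leaves-Usub : ∀ k n → leaves (Usub lam k n) ≡ 1 + (Lam lam k ∸ 1) * S n
  leaves-Usub k zero    = cong suc (sym (*-zeroʳ (Lam lam k ∸ 1)))
  leaves-Usub k (suc n) = begin
    leaves (Usub lam k n) + leavesL (replicate c (Tfin lam n))
      ≡⟨ cong₂ _+_ (leaves-Usub k n) (leavesL-replicate c (Tfin lam n)) ⟩
    1 + c * S n + c * L n
      ≡⟨ cong suc (sym (*-distribˡ-+ c (S n) (L n))) ⟩
    1 + c * S (suc n) ∎
    where c = Lam lam k ∸ 1

  S-suc : 1 ≤ lam 1 → ∀ j → S (suc j) ≡ 1 + (∑[ m < j ] (Lam lam (j ∸ m) * L m))
  S-suc λ₁≥1 j = begin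
    S j + L j
      ≡⟨ cong (S j +_) (leaves-Tfin j) ⟩
    S j + (1 + (∑[ m < j ] ((Lam lam (j ∸ m) ∸ 1) * L m)))
      ≡⟨ +-comm (S j) _ ⟩
    1 + (∑[ m < j ] ((Lam lam (j ∸ m) ∸ 1) * L m)) + S j
      ≡⟨ cong suc (sym (∑<-+ j (λ m → (Lam lam (j ∸ m) ∸ 1) * L m) L)) ⟩
    1 + (∑[ m < j ] ((Lam lam (j ∸ m) ∸ 1) * L m + L m))
      ≡⟨ cong suc (∑<-cong j (λ m m<j → [m∸1]*n+n≡m*n (L m) (Lam-positive λ₁≥1 (m<n⇒0<n∸m m<j)))) ⟩
    1 + (∑[ m < j ] (Lam lam (j ∸ m) * L m)) ∎

  S-recurrence : 1 ≤ lam 1 → ∀ j → S (suc j) ≡ 1 + (∑[ i < j ] (lam (suc i) * S (j ∸ i)))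
  S-recurrence λ₁≥1 j = begin
    S (suc j)
      ≡⟨ S-suc λ₁≥1 j ⟩
    1 + (∑[ m < j ] (Lam lam (j ∸ m) * L m))
      ≡⟨ cong suc (∑<-cong j (λ m _ → cong (_* L m) (Lam-∑< lam (j ∸ m)))) ⟩
    1 + (∑[ m < j ] (∑< (j ∸ m) (λ i → lam (suc i)) * L m))
      ≡⟨ cong suc (∑<-convolution j (λ i → lam (suc i)) L) ⟩
    1 + (∑[ i < j ] (lam (suc i) * S (j ∸ i))) ∎

  S-recurrence-Admissible : ∀ {k} → Admissible lam k →
    ∀ j → S (suc j) ≡ 1 + (∑[ i < k ] (lam (suc i) * S (j ∸ i)))
  S-recurrence-Admissible {k} adm j = begin
    S (suc j)            ≡⟨ S-recurrence λ₁≥1 j ⟩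
    1 + ∑< j term        ≡⟨ cong suc (sym (∑<-vanishing j k term beyond-j)) ⟩
    1 + ∑< (j + k) term  ≡⟨ cong (λ n → 1 + ∑< n term) (+-comm j k) ⟩
    1 + ∑< (k + j) term  ≡⟨ cong suc (∑<-vanishing k j term beyond-k) ⟩
    1 + ∑< k term        ∎
    where
    open Admissible adm
    term : ℕ → ℕ
    term i = lam (suc i) * S (j ∸ i)
    beyond-j : ∀ i → j ≤ i → term i ≡ 0
    beyond-j i j≤i = trans (cong (λ n → lam (suc i) * S n) (m≤n⇒m∸n≡0 j≤i)) (*-zeroʳ (lam (suc i)))
    beyond-k : ∀ i → k ≤ i → term i ≡ 0
    beyond-k i k≤i = cong (_* S (j ∸ i)) (vanish (suc i) (s≤s k≤i))

  leaves-Usub-recurrence : ∀ {k} → Admissible lam k →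
    ∀ n → leaves (Usub lam k (suc n)) ≡ ∑[ i < k ] (lam (suc i) * leaves (Usub lam k (n ∸ i)))
  leaves-Usub-recurrence {k} adm n = begin
    leaves (Usub lam k (suc n))        ≡⟨ leaves-Usub k (suc n) ⟩
    1 + c * S (suc n)                  ≡⟨ cong (λ s → 1 + c * s) (S-recurrence-Admissible adm n) ⟩
    1 + c * (1 + Z)                    ≡⟨ cong suc (*-suc c Z) ⟩
    1 + c + c * Z                      ≡⟨ cong (_+ c * Z) (m+[n∸m]≡n (Lam-positive λ₁≥1 k≥1)) ⟩
    Lam lam k + c * Z                  ≡⟨ cong₂ _+_ (Lam-∑< lam k) (sym (∑<-*ˡ k c term)) ⟩
    (∑[ i < k ] lam (suc i)) + (∑[ i < k ] (c * term i))
      ≡⟨ sym (∑<-+ k (λ i → lam (suc i)) (λ i → c * term i)) ⟩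
    ∑[ i < k ] (lam (suc i) + c * term i)
      ≡⟨ ∑<-cong k (λ i _ → distrib (lam (suc i)) (n ∸ i)) ⟩
    ∑[ i < k ] (lam (suc i) * leaves (Usub lam k (n ∸ i))) ∎
    where
    open Admissible adm
    c : ℕ
    c = Lam lam k ∸ 1
    term : ℕ → ℕ
    term i = lam (suc i) * S (n ∸ i)
    Z : ℕ
    Z = ∑< k term
    distrib : ∀ x m → x + c * (x * S m) ≡ x * leaves (Usub lam k m)
    distrib x m = begin
      x + c * (x * S m)  ≡⟨ cong (x +_) (x∙yz≈y∙xz c x (S m)) ⟩
      x + x * (c * S m)  ≡⟨ sym (*-suc x (c * S m)) ⟩
      x * (1 + c * S m)  ≡⟨ cong (x *_) (sym (leaves-Usub k m)) ⟩
      x * leaves (Usub lam k m) ∎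

nth-hist : ∀ lam k m i → nth (hist lam k m) i 1 ≡ seqA lam k (m ∸ i)
nth-hist lam k zero    zero    = refl
nth-hist lam k zero    (suc i) = refl
nth-hist lam k (suc m) zero    = refl
nth-hist lam k (suc m) (suc i) = nth-hist lam k m i

seqA-recurrence : ∀ lam k n → seqA lam k (suc n) ≡ ∑[ i < k ] (lam (suc i) * seqA lam k (n ∸ i))
seqA-recurrence lam k n = begin
  sum (map (λ i → lam (suc i) * nth (hist lam k n) i 1) (upTo k))
    ≡⟨ sum-map-upTo k (λ i → lam (suc i) * nth (hist lam k n) i 1) ⟩
  ∑[ i < k ] (lam (suc i) * nth (hist lam k n) i 1)
    ≡⟨ ∑<-cong k (λ i _ → cong (lam (suc i) *_) (nth-hist lam k n i)) ⟩
  ∑[ i < k ] (lam (suc i) * seqA lam k (n ∸ i)) ∎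

-- For i ≥ n the index n ∸ i truncates to 0, where b is 1, matching a_m = 1 for m ≤ 0.
seqA-unique : ∀ lam k (b : ℕ → ℕ) → b 0 ≡ 1 →
  (∀ n → b (suc n) ≡ ∑[ i < k ] (lam (suc i) * b (n ∸ i))) → ∀ n → seqA lam k n ≡ b n
seqA-unique lam k b b₀ b-rec = <-rec (λ n → seqA lam k n ≡ b n) step
  where
  step : ∀ n → (∀ {m} → m < n → seqA lam k m ≡ b m) → seqA lam k n ≡ b n
  step zero    _  = sym b₀
  step (suc n) ih = begin
    seqA lam k (suc n)                              ≡⟨ seqA-recurrence lam k n ⟩
    ∑[ i < k ] (lam (suc i) * seqA lam k (n ∸ i))   ≡⟨ ∑<-cong k (λ i _ → cong (lam (suc i) *_) (ih (s≤s (m∸n≤m n i)))) ⟩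
    ∑[ i < k ] (lam (suc i) * b (n ∸ i))            ≡⟨ sym (b-rec n) ⟩
    b (suc n)                                       ∎

corollary4p8 : (lam : ℕ → ℕ) (k : ℕ) → Admissible lam k →
    (t : ℕ) → 1 ≤ t → leaves (Usub lam k t) ≡ seqA lam k t
corollary4p8 lam k adm t _ =
  sym (seqA-unique lam k (λ n → leaves (Usub lam k n)) refl (leaves-Usub-recurrence adm) t)
  where open LeafCounts lam
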